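{- If $M$ is a $\mathbf{G}$-countermodel for $\varphi$, then for any choice function $rep$ the generated model $\mathrm{gen}(\mathrm{SMC}_{\mathbf{G}})$ is a $\mathbf{G}$-countermodel for $\varphi$, and there is a constant $C$, independent of $\varphi$ and $M$, such that $|W(\mathrm{gen}(\mathrm{SMC}_{\mathbf{G}}))|\le C\cdot|\varphi|^2$.
   Context: Formulas: $x\in\mathit{Var}\mid\neg\psi\mid\psi_1\wedge\psi_2\mid\Box\psi\mid\mathcal{O}(\psi_1\mid\psi_2)$; $|\varphi|$ is the number of symbols; $\mathrm{Cond}(\varphi)=\{\alpha:\mathcal{O}(\gamma\mid\alpha)\text{ a subformula of }\varphi\}$. A preference model $M=\langle W,\succeq,\mathbb{V}\rangle$: $W$ nonempty, $\succeq$ binary relation, $\mathbb{V}\colon\mathit{Var}\to\mathcal{P}(W)$; $w_1\succ w_2$ iff $w_1\succeq w_2$ and not $w_2\succeq w_1$; $\max_\succ(U)=\{v\in U:\neg\exists u\in U,u\succ v\}$; $\mathrm{Bet}(v)=\{w:w\succ v\}$. Truth sets: $\|x\|=\mathbb{V}(x)$, $\|\neg\psi\|=W\setminus\|\psi\|$, $\|\psi_1\wedge\psi_2\|=\|\psi_1\|\cap\|\psi_2\|$, $\|\Box\beta\|=W$ if $\|\beta\|=W$ else $\emptyset$, $\|\mathcal{O}(\gamma\mid\alpha)\|=W$ if $\max_\succ(\|\alpha\|)\subseteq\|\gamma\|$ else $\emptyset$; $M\models\psi$ iff $\|\psi\|=W$. $M$ is smooth if for every formula $\alpha$ and $w\in\|\alpha\|$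 there is $u\in\max_\succ(\|\alpha\|)$ with $u=w$ or $u\succ w$. $\succeq$ is total if for all $w_1,w_2$, $w_1\succeq w_2$ or $w_2\succeq w_1$. A $\mathbf{G}$-countermodel for $\varphi$ is a smooth preference model with $\succeq$ transitive and total and $M\not\models\varphi$. $rep$ assigns to each nonempty $S\subseteq W$ an element of $S$. $\mathit{Fal}(\varphi,M)=\{rep(W\setminus\|\varphi\|)\}\cup\{rep(W\setminus\|\beta\|):\Box\beta\text{ a subformula of }\varphi,M\not\models\Box\beta\}\cup\{rep(\max_\succ(\|\alpha\|)\setminus\|\gamma\|):\mathcal{O}(\gamma\mid\alpha)\text{ a subformula of }\varphi,M\not\models\mathcal{O}(\gamma\mid\alpha)\}$. A stratification of a finite $U\subseteq W$ is a sequence $[S_1,\dots,S_n]$ of nonempty sets whose disjoint union is $U$ such that for $u_i\in S_i,u_j\in S_j$: $u_i\succeq u_j$ iff $i\ge j$ (for transitive total $\succeq$ it exists and is unique). For $U\subseteq W$ and finite $\mathcal{A}$, $D(U,\mathcal{A})=U\cap\max_\succ(\|\bigvee_{\alpha\in\mathcal{A}}\alpha\|)$; $\mathrm{MaxSeq}(U,\mathcal{A})$ is empty if $\mathcal{A}=\emptyset$ or $D(U,\mathcal{A})=\emptyset$, and otherwise the list starting with $z=rep(D(U,\mathcal{A}))$ followed by $\mathrm{MaxSeq}(U,\{\alpha\in\mathcal{A}:M,z\not\models\alpha\})$. Blocks: pairs $\langle U,\succeq_U\rangle$ with $U\subseteq W$; $\mathrm{clique}(U)=\langle U,U\times U\rangle$;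 $\mathrm{chain}([w_1,\dots,w_n])=\langle\{w_1,\dots,w_n\},\succeq^{ch}\rangle$ with $w_i\succeq^{ch}w_j$ iff $i\le j$. A composite construction $\langle L,\succeq_L,\mathcal{B}\rangle$ generates the model with worlds $\{(l,w):l\in L,w\in W(\mathcal{B}(l))\}$, $(l_1,w_1)\succeq^{gen}(l_2,w_2)$ iff $l_1\succeq_L l_2$ or ($l_1=l_2$ and $w_1\succeq_U w_2$ where $\mathcal{B}(l_1)=\langle U,\succeq_U\rangle$), $(l,w)\in\mathbb{V}^{gen}(x)$ iff $w\in\mathbb{V}(x)$. $\mathrm{SMC}_{\mathbf{G}}$: let $[S_1,\dots,S_n]$ be the stratification of $\mathit{Fal}(\varphi,M)$; labels $\mathtt{f}_{S_i},\mathtt{ch}_{S_i}$ for $1\le i\le n$; $\mathcal{B}(\mathtt{f}_{S_i})=\mathrm{clique}(S_i)$, $\mathcal{B}(\mathtt{ch}_{S_i})=\mathrm{chain}(\mathrm{MaxSeq}(\mathrm{Bet}(rep(S_i)),\mathrm{Cond}(\varphi)))$; the labels are linearly ordered as $\mathtt{f}_{S_1},\mathtt{ch}_{S_1},\dots,\mathtt{f}_{S_n},\mathtt{ch}_{S_n}$, and $l\succeq_L l'$ iff $l$ occurs strictly later than $l'$ in this list. -}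

module Defs where

open import Data.Nat using (ℕ; zero; suc; _+_; _*_; _≤_; _<_)
open import Data.Bool using (Bool; true; false)
open import Data.Fin using (Fin; toℕ)
open import Data.List using (List; []; _∷_; _++_; length; lookup; filter; deduplicate; concatMap)
open import Data.List.Membership.Propositional using (_∈_)
open import Data.List.Relation.Unary.All using (All)
open import Data.List.Relation.Unary.Any using (Any)
open import Data.Product using (Σ; _×_; _,_)
open import Data.Sum using (_⊎_)
open import Data.Unit using (⊤)
open import Relation.Nullary using (¬_; Dec; yes; no)
open import Relation.Nullary.Decidable using (¬?)
open import Relation.Binary.PropositionalEquality using (_≡_)
open import Function.Bundles using (_⇔_)

data Fm : Set where
  var  : ℕ → Fm
  neg  : Fm → Fm
  _∧'_ : Fm → Fm → Fm
  box  : Fm → Fm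
  O    : Fm → Fm → Fm        -- O γ α  stands for  𝒪(γ ∣ α)

-- |φ| : number of symbols (each connective / variable counts 1;
-- parentheses are not counted -- only affects constants).
size : Fm → ℕ
size (var x)   = 1
size (neg ψ)   = suc (size ψ)
size (a ∧' b)  = suc (size a + size b)
size (box ψ)   = suc (size ψ)
size (O γ α)   = suc (size γ + size α)

subs : Fm → List Fm
subs (var x)  = var x ∷ []
subs (neg ψ)  = neg ψ ∷ subs ψ
subs (a ∧' b) = (a ∧' b) ∷ (subs a ++ subs b)
subs (box ψ)  = box ψ ∷ subs ψ
subs (O γ α)  = O γ α ∷ (subs γ ++ subs α)

condOf : Fm → List Fm
condOf (O γ α) = α ∷ []
condOf _       = []

Cond : Fm → List Fm
Cond φ = concatMap condOf (subs φ)

-- Preference models (the triple; nonemptiness of W is a separate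
-- property, see `NonEmpty`)

record Model : Set₁ where
  field
    W   : Set
    _≽_ : W → W → Set
    V   : ℕ → W → Set

module _ (M : Model) where
  open Model M

  _≻_ : W → W → Set
  a ≻ b = (a ≽ b) × ¬ (b ≽ a)

  Max : (W → Set) → W → Set
  Max U v = U v × ¬ (Σ W λ u → U u × (u ≻ v))

  sat : W → Fm → Set
  sat w (var x)  = V x w
  sat w (neg ψ)  = ¬ sat w ψ
  sat w (a ∧' b) = sat w a × sat w b
  sat w (box β)  = ∀ v → sat v β
  sat w (O γ α)  = ∀ v → sat v α → ¬ (Σ W λ u → sat u α × (u ≻ v)) → sat v γ

  valid : Fm → Set
  valid ψ = ∀ w → sat w ψ

  NonEmpty : Set
  NonEmpty = W

  Smooth : Set
  Smooth = ∀ (α : Fm) (w : W) → sat w α →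
           Σ W λ u → Max (λ v → sat v α) u × ((u ≡ w) ⊎ (u ≻ w))

  Transitive : Set
  Transitive = ∀ a b c → a ≽ b → b ≽ c → a ≽ c

  Total : Set
  Total = ∀ a b → (a ≽ b) ⊎ (b ≽ a)

  GCounter : Fm → Set
  GCounter φ = NonEmpty × Smooth × Transitive × Total × ¬ valid φ

  -- rep : a choice function on the nonempty subsets of W
  -- (subsets as predicates; rep is extensional and picks a member)
  IsRep : ((W → Set) → W) → Set₁
  IsRep rep = (∀ (S : W → Set) → Σ W S → S (rep S))
            × (∀ (S S' : W → Set) → (∀ w → S w ⇔ S' w) → rep S ≡ rep S')

-- Classical logic oracle (the construction is non-constructive)

LEM : Set₁
LEM = (P : Set) → Dec P

module Construction (lem : LEM) (M : Model) (rep : (Model.W M → Set) → Model.W M)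
                    (φ : Fm) where
  open Model M

  falOf : Fm → List W
  falOf (box β) with lem (valid M (box β))
  ... | yes _ = []
  ... | no  _ = rep (λ w → ¬ sat M w β) ∷ []
  falOf (O γ α) with lem (valid M (O γ α))
  ... | yes _ = []
  ... | no  _ = rep (λ w → Max M (λ u → sat M u α) w × ¬ sat M w γ) ∷ []
  falOf _ = []

  Fal : List W
  Fal = deduplicate (λ a b → lem (a ≡ b))
          (rep (λ w → ¬ sat M w φ) ∷ concatMap falOf (subs φ))

  -- stratification [S₁,…,Sₙ] (S₁ lowest): repeatedly peel off the
  -- elements that are ≼ every remaining element.  (fuel = length)
  stratAux : ℕ → List W → List W → List (List W)
  stratAux n xs []            = []
  stratAux n xs bot@(_ ∷ _)   =
    bot ∷ strat' n (filter (λ x → ¬? (lem (x ∈ bot))) xs)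
    where
    strat' : ℕ → List W → List (List W)
    strat' zero    ys = []
    strat' (suc m) ys = stratAux m ys (filter (λ x → lem (All (λ y → y ≽ x) ys)) ys)

  strat : ℕ → List W → List (List W)
  strat zero    xs = []
  strat (suc n) xs = stratAux n xs (filter (λ x → lem (All (λ y → y ≽ x) xs)) xs)

  Strata : List (List W)
  Strata = strat (length Fal) Fal

  Bet : W → W → Set
  Bet v w = _≻_ M w v

  D : (W → Set) → List Fm → W → Set
  D U A w = U w × Max M (λ u → Any (λ α → sat M u α) A) w

  -- MaxSeq(U, 𝒜)   (fuel ≥ |𝒜| suffices; 𝒜 shrinks at each step)
  MaxSeq : ℕ → (W → Set) → List Fm → List W
  MaxSeq zero    U A        = []
  MaxSeq (suc n) U []       = []
  MaxSeq (suc n) U A@(_ ∷ _) with lem (Σ W (D U A))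
  ... | no  _ = []
  ... | yes _ = z ∷ MaxSeq n U (filter (λ α → ¬? (lem (sat M z α))) A)
    where z = rep (D U A)

  nS : ℕ
  nS = length Strata

  -- labels: (i , false) = f_{S_i},  (i , true) = ch_{S_i}
  Label : Set
  Label = Fin nS × Bool

  pos : Label → ℕ
  pos (i , false) = toℕ i + toℕ i
  pos (i , true)  = suc (toℕ i + toℕ i)

  _≽L_ : Label → Label → Set
  l ≽L l' = pos l' < pos l

  S : Fin nS → List W
  S i = lookup Strata i

  blk : Label → List W
  blk (i , false) = S i
  blk (i , true)  = MaxSeq (length (Cond φ)) (Bet (rep (λ u → u ∈ S i))) (Cond φ)

  -- relation inside a block, on positions:
  -- clique: everything related; chain: w_a ≽ w_b iff a ≤ b
  blkRel : Label → ℕ → ℕ → Set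
  blkRel (i , false) a b = ⊤
  blkRel (i , true)  a b = a ≤ b

  Wgen : Set
  Wgen = Σ Label λ l → Fin (length (blk l))

  _≽gen_ : Wgen → Wgen → Set
  (l₁ , k₁) ≽gen (l₂ , k₂) = (l₁ ≽L l₂) ⊎ ((l₁ ≡ l₂) × blkRel l₁ (toℕ k₁) (toℕ k₂))

  Vgen : ℕ → Wgen → Set
  Vgen x (l , k) = V x (lookup (blk l) k)

  gen : Model
  gen = record { W = Wgen ; _≽_ = _≽gen_ ; V = Vgen }

-- The generated model keeps a copy of every world of Fal(φ, M), grouped by stratum, and
-- above each stratum S a chain of worlds strictly better than rep(S), maximal for successively
-- fewer antecedents from Cond(φ). Every subformula of φ then has the same truth value at a
-- generated world as at its original in M. If □β or 𝒪(γ ∣ α) fails in M, it fails at a copied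
-- world of Fal, and everything above that copy in the generated order is already strictly
-- better in M, so α-maximality carries over. Conversely, an α-world of M above a generated
-- world is matched in the chain of its stratum, whose first α-world is α-maximal in M.
-- The generated order is a finite lexicographic order, hence upward well-founded and smooth;
-- with at most 2|φ| strata, f-blocks of at most 2|φ| and chains of at most |φ| worlds, it has
-- at most 6|φ|² worlds.

{-# OPTIONS --safe #-}
module Submission where

open import Defs
open import Data.Bool using (Bool; true; false)
open import Data.Empty using (⊥-elim)
open import Data.Fin using (Fin; toℕ; zero; suc)
open import Data.Fin.Properties using (toℕ<n; toℕ-injective; +↔⊎)
open import Data.List using (List; []; _∷_; _++_; length; lookup; filter; concatMap)
open import Data.List.Properties using (length-++; length-filter; filter-notAll; length-deduplicate)
open import Data.List.Membership.Propositional using (_∈_; lose)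
open import Data.List.Membership.Propositional.Properties
  using (∈-filter⁺; ∈-filter⁻; ∈-lookup; ∈-concatMap⁺; ∈-deduplicate⁺; ∈-++⁺ˡ; ∈-++⁺ʳ)
open import Data.List.Relation.Binary.Subset.Propositional using (_⊆_)
open import Data.List.Relation.Unary.All as All using (All; []; _∷_)
open import Data.List.Relation.Unary.AllPairs using (AllPairs; []; _∷_)
open import Data.List.Relation.Unary.Any as Any using (Any; here; there)
open import Data.List.Relation.Unary.Any.Properties using (lookup-index)
open import Data.Nat using (ℕ; zero; suc; _+_; _*_; _∸_; _≤_; _<_; z≤n; s≤s; ⌊_/2⌋)
open import Data.Nat.Induction using (<-wellFounded)
open import Data.Nat.Properties
open import Data.Nat.Tactic.RingSolver using (solve-∀)
open import Data.Product using (Σ; _×_; _,_; proj₁; proj₂)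
open import Data.Product.Function.Dependent.Propositional using (Σ-↔)
open import Data.Product.Relation.Binary.Lex.Strict using (×-Lex; ×-wellFounded)
open import Data.Sum using (_⊎_; inj₁; inj₂; [_,_]; [_,_]′)
open import Data.Sum.Function.Propositional using (_⊎-↔_)
open import Data.Unit using (tt)
open import Relation.Binary.Definitions using (tri<; tri≈; tri>)
open import Data.Vec.Functional using (Vector; tail)
open import Function using (_∘_; id)
open import Function.Bundles using (_↔_; _⇔_; mk↔ₛ′; mk⇔; Equivalence)
open import Function.Properties.Inverse using (↔-refl; ↔-sym; ↔-trans)
open import Function.Related.TypeIsomorphisms using (Σ-assoc)
open import Induction.WellFounded using (WellFounded; Acc; acc; module Subrelation)
open import Relation.Binary.Construct.On as On using ()
open import Relation.Binary.PropositionalEquality using (_≡_; refl; sym; trans; cong; subst; subst₂)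
open import Relation.Nullary using (¬_; yes; no)
open import Relation.Nullary.Decidable using (¬?; decidable-stable)
open import Algebra.Properties.Monoid.Sum +-0-monoid using (sum)

open Equivalence using (to; from)

Σ-Fin-suc↔⊎ : ∀ {n} (P : Fin (suc n) → Set) → Σ (Fin (suc n)) P ↔ (P zero ⊎ Σ (Fin n) (P ∘ suc))
Σ-Fin-suc↔⊎ P = mk↔ₛ′
  (λ { (zero , p) → inj₁ p ; (suc i , p) → inj₂ (i , p) })
  (λ { (inj₁ p) → zero , p ; (inj₂ (i , p)) → suc i , p })
  (λ { (inj₁ p) → refl ; (inj₂ (i , p)) → refl })
  (λ { (zero , p) → refl ; (suc i , p) → refl })

Σ-Bool↔⊎ : (P : Bool → Set) → Σ Bool P ↔ (P false ⊎ P true)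
Σ-Bool↔⊎ P = mk↔ₛ′
  (λ { (false , p) → inj₁ p ; (true , p) → inj₂ p })
  (λ { (inj₁ p) → false , p ; (inj₂ p) → true , p })
  (λ { (inj₁ p) → refl ; (inj₂ p) → refl })
  (λ { (false , p) → refl ; (true , p) → refl })

Σ-Fin↔Fin-sum : ∀ {n} (h : Vector ℕ n) → Σ (Fin n) (Fin ∘ h) ↔ Fin (sum h)
Σ-Fin↔Fin-sum {zero}  h = mk↔ₛ′ (λ { (() , _) }) (λ ()) (λ ()) (λ { (() , _) })
Σ-Fin↔Fin-sum {suc n} h = ↔-trans (Σ-Fin-suc↔⊎ (Fin ∘ h))
  (↔-trans (↔-refl ⊎-↔ Σ-Fin↔Fin-sum (tail h)) (↔-sym +↔⊎))

sum≤n*B : ∀ {n} (h : Vector ℕ n) {B} → (∀ i → h i ≤ B) → sum h ≤ n * B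
sum≤n*B {zero}  h h≤B = z≤n
sum≤n*B {suc n} h h≤B = +-mono-≤ (h≤B zero) (sum≤n*B (tail h) (h≤B ∘ suc))

length-concatMap≤ : ∀ {A B : Set} (f : A → List B) → (∀ x → length (f x) ≤ 1) →
                    ∀ xs → length (concatMap f xs) ≤ length xs
length-concatMap≤ f f≤1 []       = z≤n
length-concatMap≤ f f≤1 (x ∷ xs) = begin
  length (f x ++ concatMap f xs)          ≡⟨ length-++ (f x) ⟩
  length (f x) + length (concatMap f xs)  ≤⟨ +-mono-≤ (f≤1 x) (length-concatMap≤ f f≤1 xs) ⟩
  suc (length xs)                         ∎
  where open ≤-Reasoning

AllPairs-lookup : ∀ {A : Set} {R : A → A → Set} {xs : List A} → AllPairs R xs →
                  ∀ {i j : Fin (length xs)} → toℕ i < toℕ j → R (lookup xs i) (lookup xs j)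
AllPairs-lookup (Rx ∷ _)   {zero}  {suc j} _         = All.lookup Rx (∈-lookup j)
AllPairs-lookup (_  ∷ Rxs) {suc i} {suc j} (s≤s i<j) = AllPairs-lookup Rxs i<j

1≤size : ∀ ψ → 1 ≤ size ψ
1≤size (var _)  = s≤s z≤n
1≤size (neg _)  = s≤s z≤n
1≤size (_ ∧' _) = s≤s z≤n
1≤size (box _)  = s≤s z≤n
1≤size (O _ _)  = s≤s z≤n

length-subs≤size : ∀ ψ → length (subs ψ) ≤ size ψ
length-subs++subs≤ : ∀ ψ χ → length (subs ψ ++ subs χ) ≤ size ψ + size χ

length-subs≤size (var _)  = ≤-refl
length-subs≤size (neg ψ)  = s≤s (length-subs≤size ψ)
length-subs≤size (ψ ∧' χ) = s≤s (length-subs++subs≤ ψ χ)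
length-subs≤size (box ψ)  = s≤s (length-subs≤size ψ)
length-subs≤size (O γ α)  = s≤s (length-subs++subs≤ γ α)

length-subs++subs≤ ψ χ = ≤-trans (≤-reflexive (length-++ (subs ψ)))
                                 (+-mono-≤ (length-subs≤size ψ) (length-subs≤size χ))

length-Cond≤size : ∀ ψ → length (Cond ψ) ≤ size ψ
length-Cond≤size ψ = ≤-trans (length-concatMap≤ condOf condOf≤1 (subs ψ)) (length-subs≤size ψ)
  where
  condOf≤1 : ∀ χ → length (condOf χ) ≤ 1
  condOf≤1 (var _)  = z≤n
  condOf≤1 (neg _)  = z≤n
  condOf≤1 (_ ∧' _) = z≤n
  condOf≤1 (box _)  = z≤n
  condOf≤1 (O _ _)  = ≤-refl

module Classical (lem : LEM) where

  dne : ∀ {P : Set} → ¬ ¬ P → P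
  dne {P} = decidable-stable (lem P)

  ¬∀⇒∃¬ : ∀ {A : Set} {P : A → Set} → ¬ (∀ x → P x) → Σ A (λ x → ¬ P x)
  ¬∀⇒∃¬ ¬∀ = dne λ ¬∃ → ¬∀ λ x → dne λ ¬Px → ¬∃ (x , ¬Px)

module Preference (M : Model) where
  open Model M

  ≽-refl : Total M → ∀ a → a ≽ a
  ≽-refl total a = [ id , id ] (total a a)

  module _ (≽-trans : Transitive M) where

    ≽-≻-trans : ∀ {a b c} → a ≽ b → _≻_ M b c → _≻_ M a c
    ≽-≻-trans a≽b (b≽c , c⋡b) = ≽-trans _ _ _ a≽b b≽c , λ c≽a → c⋡b (≽-trans _ _ _ c≽a a≽b)

    ≻-≽-trans : ∀ {a b c} → _≻_ M a b → b ≽ c → _≻_ M a c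
    ≻-≽-trans (a≽b , b⋡a) b≽c = ≽-trans _ _ _ a≽b b≽c , λ c≽a → b⋡a (≽-trans _ _ _ b≽c c≽a)

    ≻-trans : ∀ {a b c} → _≻_ M a b → _≻_ M b c → _≻_ M a c
    ≻-trans a≻b (b≽c , _) = ≻-≽-trans a≻b b≽c

smooth-of-wellFounded : LEM → (M : Model) → Transitive M → WellFounded (_≻_ M) → Smooth M
smooth-of-wellFounded lem M ≽-trans wf α w wα = climb w (wf w) wα
  where
  open Model M
  open Preference M using (≻-trans)
  climb : ∀ x → Acc (_≻_ M) x → sat M x α →
          Σ W λ u → Max M (λ v → sat M v α) u × ((u ≡ x) ⊎ _≻_ M u x)
  climb x (acc above) xα with lem (Σ W λ u → sat M u α × _≻_ M u x)
  ... | no  x-max           = x , (xα , x-max) , inj₁ refl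
  ... | yes (u , uα , u≻x) with climb u (above u≻x) uα
  ...   | v , v-max , v≥u =
    v , v-max , inj₂ ([ (λ { refl → u≻x }) , (λ v≻u → ≻-trans ≽-trans v≻u u≻x) ] v≥u)

module SMC (lem : LEM) (M : Model) (rep : (Model.W M → Set) → Model.W M) (φ : Fm) where
  open Model M
  open Construction lem M rep φ
  open Classical lem
  open Preference M

  infix 4 _⊨_ _≻ᴹ_

  _⊨_ : W → Fm → Set
  w ⊨ ψ = sat M w ψ

  _≻ᴹ_ : W → W → Set
  _≻ᴹ_ = _≻_ M

  -- Stratification

  Lowest : List W → W → Set
  Lowest xs x = All (_≽ x) xs

  bottom : List W → List W
  bottom xs = filter (λ x → lem (Lowest xs x)) xs

  _without_ : List W → List W → List W
  xs without b = filter (λ x → ¬? (lem (x ∈ b))) xs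

  ∈-bottom⁻ : ∀ {xs x} → x ∈ bottom xs → x ∈ xs × Lowest xs x
  ∈-bottom⁻ {xs} = ∈-filter⁻ (λ x → lem (Lowest xs x))

  ∈-bottom⁺ : ∀ {xs x} → x ∈ xs → Lowest xs x → x ∈ bottom xs
  ∈-bottom⁺ {xs} = ∈-filter⁺ (λ x → lem (Lowest xs x))

  ∈-without⁻ : ∀ {xs b x} → x ∈ xs without b → x ∈ xs × ¬ x ∈ b
  ∈-without⁻ {xs} {b} = ∈-filter⁻ (λ x → ¬? (lem (x ∈ b)))

  ∈-without⁺ : ∀ {xs b x} → x ∈ xs → ¬ x ∈ b → x ∈ xs without b
  ∈-without⁺ {xs} {b} = ∈-filter⁺ (λ x → ¬? (lem (x ∈ b)))

  lowest-exists : Transitive M → Total M → ∀ {x xs} → x ∈ xs → Σ W λ y → y ∈ xs × Lowest xs y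
  lowest-exists ≽-trans ≽-total {xs = a ∷ as} _ = lowest-of-cons a as
    where
    lowest-of-cons : ∀ a as → Σ W λ y → y ∈ a ∷ as × Lowest (a ∷ as) y
    lowest-of-cons a []       = a , here refl , ≽-refl ≽-total a ∷ []
    lowest-of-cons a (b ∷ bs) with lowest-of-cons b bs
    ... | m , m∈ , m-lowest with ≽-total a m
    ...   | inj₁ a≽m = m , there m∈ , a≽m ∷ m-lowest
    ...   | inj₂ m≽a = a , here refl ,
                       ≽-refl ≽-total a ∷ All.map (λ y≽m → ≽-trans _ _ _ y≽m m≽a) m-lowest

  -- One unfolding of `strat`, independent of how `stratAux` splits its fuel.
  data Peeling (n : ℕ) (xs : List W) : List (List W) → Set where
    exhausted : bottom xs ≡ [] → Peeling n xs []
    layer     : Σ W (_∈ bottom xs) →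
                Peeling n xs (bottom xs ∷ strat n (xs without bottom xs))

  peeling : ∀ n xs → Peeling n xs (strat (suc n) xs)
  peeling n xs = unfold n (bottom xs) refl
    where
    cons-layer : ∀ {m b bs} → bottom xs ≡ b ∷ bs →
                 Peeling m xs ((b ∷ bs) ∷ strat m (xs without (b ∷ bs)))
    cons-layer {m} {b} eq = subst (λ s → Peeling m xs (s ∷ strat m (xs without s))) eq
                                  (layer (b , subst (b ∈_) (sym eq) (here refl)))
    unfold : ∀ m b → bottom xs ≡ b → Peeling m xs (stratAux m xs b)
    unfold m       []       eq = exhausted eq
    unfold zero    (b ∷ bs) eq = cons-layer eq
    unfold (suc m) (b ∷ bs) eq = cons-layer eq

  strat-⊆ : ∀ n xs {s} → s ∈ strat n xs → s ⊆ xs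
  strat-⊆ zero    xs ()
  strat-⊆ (suc n) xs s∈ with strat (suc n) xs | peeling n xs | s∈
  ... | _ | layer _ | here refl  = λ x∈ → proj₁ (∈-bottom⁻ x∈)
  ... | _ | layer _ | there s∈′ = λ x∈ → proj₁ (∈-without⁻ (strat-⊆ n _ s∈′ x∈))

  strat-nonempty : ∀ n xs {s} → s ∈ strat n xs → Σ W (_∈ s)
  strat-nonempty zero    xs ()
  strat-nonempty (suc n) xs s∈ with strat (suc n) xs | peeling n xs | s∈
  ... | _ | layer ne | here refl  = ne
  ... | _ | layer _  | there s∈′ = strat-nonempty n _ s∈′

  strat-clique : ∀ n xs {s} → s ∈ strat n xs → ∀ {x y} → x ∈ s → y ∈ s → x ≽ y
  strat-clique zero    xs ()
  strat-clique (suc n) xs s∈ with strat (suc n) xs | peeling n xs | s∈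
  ... | _ | layer _ | here refl  =
    λ x∈ y∈ → All.lookup (proj₂ (∈-bottom⁻ {xs} y∈)) (proj₁ (∈-bottom⁻ {xs} x∈))
  ... | _ | layer _ | there s∈′ = strat-clique n _ s∈′

  stratum-length≤ : ∀ n xs {s} → s ∈ strat n xs → length s ≤ length xs
  stratum-length≤ zero    xs ()
  stratum-length≤ (suc n) xs s∈ with strat (suc n) xs | peeling n xs | s∈
  ... | _ | layer _ | here refl  = length-filter _ xs
  ... | _ | layer _ | there s∈′ = ≤-trans (stratum-length≤ n _ s∈′) (length-filter _ xs)

  length-strat≤ : ∀ n xs → length (strat n xs) ≤ n
  length-strat≤ zero    xs = z≤n
  length-strat≤ (suc n) xs with strat (suc n) xs | peeling n xs
  ... | _ | exhausted _ = z≤n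
  ... | _ | layer _     = s≤s (length-strat≤ n _)

  Below : List W → List W → Set
  Below s t = ∀ {x y} → x ∈ s → y ∈ t → y ≻ᴹ x

  strat-sorted : Transitive M → ∀ n xs → AllPairs Below (strat n xs)
  strat-sorted ≽-trans zero    xs = []
  strat-sorted ≽-trans (suc n) xs with strat (suc n) xs | peeling n xs
  ... | _ | exhausted _ = []
  ... | _ | layer _     = All.tabulate bottom-below ∷ strat-sorted ≽-trans n _
    where
    bottom-below : ∀ {t} → t ∈ strat n (xs without bottom xs) → Below (bottom xs) t
    bottom-below t∈ x∈ y∈ with ∈-without⁻ {xs} (strat-⊆ n _ t∈ y∈) | ∈-bottom⁻ {xs} x∈
    ... | y∈xs , y∉bottom | _ , x-lowest =
      All.lookup x-lowest y∈xs ,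
      λ x≽y → y∉bottom (∈-bottom⁺ y∈xs (All.map (λ z≽x → ≽-trans _ _ _ z≽x x≽y) x-lowest))

  strat-covers : Transitive M → Total M → ∀ n xs → length xs ≤ n →
                 ∀ {x} → x ∈ xs → Any (x ∈_) (strat n xs)
  strat-covers ≽-trans ≽-total zero    [] _ ()
  strat-covers ≽-trans ≽-total (suc n) xs len {x} x∈ with strat (suc n) xs | peeling n xs
  ... | _ | exhausted none with lowest-exists ≽-trans ≽-total x∈
  ...   | y , y∈ , y-lowest with subst (y ∈_) none (∈-bottom⁺ y∈ y-lowest)
  ...     | ()
  strat-covers ≽-trans ≽-total (suc n) xs len {x} x∈ | _ | layer (b , b∈) with lem (x ∈ bottom xs)
  ... | yes x∈b = here x∈b
  ... | no  x∉b =
    there (strat-covers ≽-trans ≽-total n (xs without bottom xs) shorter (∈-without⁺ x∈ x∉b))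
    where
    shorter : length (xs without bottom xs) ≤ n
    shorter = ≤-pred (≤-trans (filter-notAll (λ z → ¬? (lem (z ∈ bottom xs))) xs
                                (lose (proj₁ (∈-bottom⁻ b∈)) (λ ¬b∈ → ¬b∈ b∈)))
                              len)

  -- Maximal sequences

  -- Smoothness only concerns formula-definable sets, so the disjunction in D is internalised.
  ⋁ : List Fm → Fm
  ⋁ []      = var 0 ∧' neg (var 0)
  ⋁ (α ∷ A) = neg (neg α ∧' neg (⋁ A))

  ⊨⋁⇔Any : ∀ {w} A → w ⊨ ⋁ A ⇔ Any (w ⊨_) A
  ⊨⋁⇔Any []          = mk⇔ (λ (p , ¬p) → ⊥-elim (¬p p)) (λ ())
  ⊨⋁⇔Any {w} (α ∷ A) = mk⇔ ⋁⇒Any Any⇒⋁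
    where
    ⋁⇒Any : w ⊨ ⋁ (α ∷ A) → Any (w ⊨_) (α ∷ A)
    ⋁⇒Any w⊨⋁ with lem (w ⊨ α)
    ... | yes wα = here wα
    ... | no ¬wα = there (to (⊨⋁⇔Any A) (dne λ ¬w⊨⋁ → w⊨⋁ (¬wα , ¬w⊨⋁)))
    Any⇒⋁ : Any (w ⊨_) (α ∷ A) → w ⊨ ⋁ (α ∷ A)
    Any⇒⋁ (here wα)  (¬wα , _)   = ¬wα wα
    Any⇒⋁ (there wA) (_ , ¬w⊨⋁) = ¬w⊨⋁ (from (⊨⋁⇔Any A) wA)

  UpwardClosed : (W → Set) → Set
  UpwardClosed U = ∀ {a b} → U a → b ≽ a → U b

  D-nonempty : Smooth M → ∀ {U A u} → UpwardClosed U → U u → Any (u ⊨_) A → Σ W (D U A)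
  D-nonempty smooth {A = A} {u} U-up Uu uA
    with smooth (⋁ A) u (from (⊨⋁⇔Any A) uA)
  ... | v , (v⊨⋁ , v-max) , v≥u =
    v , [ (λ { refl → Uu }) , (λ v≻u → U-up Uu (proj₁ v≻u)) ] v≥u ,
    to (⊨⋁⇔Any A) v⊨⋁ , λ (y , yA , y≻v) → v-max (y , from (⊨⋁⇔Any A) yA , y≻v)

  length-MaxSeq≤ : ∀ n U A → length (MaxSeq n U A) ≤ n
  length-MaxSeq≤ zero    U A       = z≤n
  length-MaxSeq≤ (suc n) U []      = z≤n
  length-MaxSeq≤ (suc n) U (α ∷ A) with lem (Σ W (D U (α ∷ A)))
  ... | no  _ = z≤n
  ... | yes _ = s≤s (length-MaxSeq≤ n U _)

  module _ (rep∈ : ∀ (P : W → Set) → Σ W P → P (rep P)) where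

    MaxSeq⊆ : ∀ n U A (k : Fin (length (MaxSeq n U A))) → U (lookup (MaxSeq n U A) k)
    MaxSeq⊆ zero    U A ()
    MaxSeq⊆ (suc n) U [] ()
    MaxSeq⊆ (suc n) U (α ∷ A) k with lem (Σ W (D U (α ∷ A)))
    MaxSeq⊆ (suc n) U (α ∷ A) ()      | no  _
    MaxSeq⊆ (suc n) U (α ∷ A) zero    | yes d = proj₁ (rep∈ _ d)
    MaxSeq⊆ (suc n) U (α ∷ A) (suc k) | yes d = MaxSeq⊆ n U _ k

    MaxSeq-first-maximal :
      ∀ n U A {α} → α ∈ A → (k : Fin (length (MaxSeq n U A))) → lookup (MaxSeq n U A) k ⊨ α →
      Max M (_⊨ α) (lookup (MaxSeq n U A) k)
      ⊎ Σ (Fin (length (MaxSeq n U A))) (λ j → toℕ j < toℕ k × lookup (MaxSeq n U A) j ⊨ α)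
    MaxSeq-first-maximal zero    U A       α∈ ()
    MaxSeq-first-maximal (suc n) U []      ()
    MaxSeq-first-maximal (suc n) U (β ∷ A) α∈ k kα with lem (Σ W (D U (β ∷ A)))
    MaxSeq-first-maximal (suc n) U (β ∷ A) α∈ () kα | no _
    MaxSeq-first-maximal (suc n) U (β ∷ A) α∈ zero kα | yes d =
      inj₁ (kα , λ (u , uα , u≻z) → proj₂ (proj₂ (rep∈ _ d)) (u , lose α∈ uα , u≻z))
    MaxSeq-first-maximal (suc n) U (β ∷ A) {α} α∈ (suc k) kα | yes d
      with lem (rep (D U (β ∷ A)) ⊨ α)
    ... | yes zα = inj₂ (zero , s≤s z≤n , zα)
    ... | no ¬zα
      with MaxSeq-first-maximal n U _ (∈-filter⁺ (λ γ → ¬? (lem (rep (D U (β ∷ A)) ⊨ γ))) α∈ ¬zα) k kα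
    ...   | inj₁ k-max          = inj₁ k-max
    ...   | inj₂ (j , j<k , jα) = inj₂ (suc j , s≤s j<k , jα)

    MaxSeq-reaches :
      Smooth M → ∀ n U A {α} → length A ≤ n → α ∈ A → UpwardClosed U → ∀ {u} → U u → u ⊨ α →
      Σ (Fin (length (MaxSeq n U A))) λ k → lookup (MaxSeq n U A) k ⊨ α
    MaxSeq-reaches smooth zero    U []      _   ()
    MaxSeq-reaches smooth (suc n) U []      _   ()
    MaxSeq-reaches smooth (suc n) U (β ∷ A) {α} len α∈ U-up Uu uα with lem (Σ W (D U (β ∷ A)))
    ... | no ¬d = ⊥-elim (¬d (D-nonempty smooth U-up Uu (lose α∈ uα)))
    ... | yes d with lem (rep (D U (β ∷ A)) ⊨ α)
    ...   | yes zα = zero , zα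
    ...   | no ¬zα =
      let k , kα = MaxSeq-reaches smooth n U (filter unsatisfied? (β ∷ A)) shorter
                                  (∈-filter⁺ unsatisfied? α∈ ¬zα) U-up Uu uα
      in suc k , kα
      where
      unsatisfied? = λ γ → ¬? (lem (rep (D U (β ∷ A)) ⊨ γ))
      shorter : length (filter unsatisfied? (β ∷ A)) ≤ n
      shorter = ≤-pred (≤-trans (filter-notAll unsatisfied? (β ∷ A)
                                  (Any.map (λ zγ ¬zγ → ¬zγ zγ) (proj₁ (proj₂ (rep∈ _ d)))))
                                len)

  -- The generated order

  G : Model
  G = gen

  infix 4 _≻ᴳ_
  _≻ᴳ_ : Wgen → Wgen → Set
  _≻ᴳ_ = _≻_ G

  origin : Wgen → W
  origin (l , k) = lookup (blk l) k

  ⌊pos/2⌋≡index : ∀ l → ⌊ pos l /2⌋ ≡ toℕ (proj₁ l)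
  ⌊pos/2⌋≡index (i , false) = sym (n≡⌊n+n/2⌋ (toℕ i))
  ⌊pos/2⌋≡index (i , true)  = sym (n≡⌈n+n/2⌉ (toℕ i))

  pos-index-mono : ∀ {l l′} → pos l ≤ pos l′ → toℕ (proj₁ l) ≤ toℕ (proj₁ l′)
  pos-index-mono {l} {l′} = subst₂ _≤_ (⌊pos/2⌋≡index l) (⌊pos/2⌋≡index l′) ∘ ⌊n/2⌋-mono

  pos-injective : ∀ {l l′} → pos l ≡ pos l′ → l ≡ l′
  pos-injective {i , b} {j , c} eq
    with toℕ-injective (≤-antisym (pos-index-mono {i , b} {j , c} (≤-reflexive eq))
                                  (pos-index-mono {j , c} {i , b} (≤-reflexive (sym eq))))
  ... | refl = cong (i ,_) (parity b c eq)
    where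
    parity : ∀ b c → pos (i , b) ≡ pos (i , c) → b ≡ c
    parity false false _  = refl
    parity true  true  _  = refl
    parity false true  eq = ⊥-elim (1+n≢n (sym eq))
    parity true  false eq = ⊥-elim (1+n≢n eq)

  pos≤ : ∀ l → pos l ≤ nS + nS
  pos≤ (i , false) = +-mono-≤ (<⇒≤ (toℕ<n i)) (<⇒≤ (toℕ<n i))
  pos≤ (i , true)  = +-mono-≤ (toℕ<n i) (<⇒≤ (toℕ<n i))

  after-f-block : ∀ {i j c} → pos (i , false) < pos (j , c) → toℕ i < toℕ j ⊎ (j , c) ≡ (i , true)
  after-f-block {i} {j} {c} lt with m≤n⇒m<n∨m≡n (pos-index-mono {i , false} {j , c} (<⇒≤ lt))
  ... | inj₁ i<j = inj₁ i<j
  ... | inj₂ i≡j with toℕ-injective i≡j | c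
  ...   | refl | true  = inj₂ refl
  ...   | refl | false = ⊥-elim (<-irrefl refl lt)

  blkRel-trans : ∀ l {a b c} → blkRel l a b → blkRel l b c → blkRel l a c
  blkRel-trans (_ , false) _   _   = tt
  blkRel-trans (_ , true)  a≤b b≤c = ≤-trans a≤b b≤c

  blkRel-total : ∀ l a b → blkRel l a b ⊎ blkRel l b a
  blkRel-total (_ , false) _ _ = inj₁ tt
  blkRel-total (_ , true)  a b = ≤-total a b

  ≽ᴳ-trans : Transitive G
  ≽ᴳ-trans _ _ _ (inj₁ l₂<l₁)      (inj₁ l₃<l₂)      = inj₁ (<-trans l₃<l₂ l₂<l₁)
  ≽ᴳ-trans _ _ _ (inj₁ l₂<l₁)      (inj₂ (refl , _)) = inj₁ l₂<l₁
  ≽ᴳ-trans _ _ _ (inj₂ (refl , _)) (inj₁ l₃<l₂)      = inj₁ l₃<l₂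
  ≽ᴳ-trans (l , _) _ _ (inj₂ (refl , k₁≽k₂)) (inj₂ (refl , k₂≽k₃)) =
    inj₂ (refl , blkRel-trans l k₁≽k₂ k₂≽k₃)

  ≽ᴳ-total : Total G
  ≽ᴳ-total (l₁ , k₁) (l₂ , k₂) with <-cmp (pos l₁) (pos l₂)
  ... | tri< l₁<l₂ _ _ = inj₂ (inj₁ l₁<l₂)
  ... | tri> _ _ l₂<l₁ = inj₁ (inj₁ l₂<l₁)
  ... | tri≈ _ eq _ with pos-injective {l₁} {l₂} eq
  ...   | refl = [ (λ k₁≽k₂ → inj₁ (inj₂ (refl , k₁≽k₂))) , (λ k₂≽k₁ → inj₂ (inj₂ (refl , k₂≽k₁))) ]′
                   (blkRel-total l₁ (toℕ k₁) (toℕ k₂))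

  ≻ᴳ-cases : ∀ {l₁ k₁ l₂ k₂} → (l₁ , k₁) ≻ᴳ (l₂ , k₂) →
             pos l₂ < pos l₁ ⊎ (l₁ ≡ l₂ × proj₂ l₁ ≡ true × toℕ k₁ < toℕ k₂)
  ≻ᴳ-cases (inj₁ l₂<l₁ , _) = inj₁ l₂<l₁
  ≻ᴳ-cases {i , false} (inj₂ (refl , _) , ≱) = ⊥-elim (≱ (inj₂ (refl , tt)))
  ≻ᴳ-cases {i , true}  (inj₂ (refl , _) , ≱) = inj₂ (refl , refl , ≰⇒> λ k₂≤k₁ → ≱ (inj₂ (refl , k₂≤k₁)))

  ≻ᴳ-wellFounded : WellFounded _≻ᴳ_
  ≻ᴳ-wellFounded = Subrelation.wellFounded ≻ᴳ⇒lower
                     (On.wellFounded height (×-wellFounded <-wellFounded <-wellFounded))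
    where
    height : Wgen → ℕ × ℕ
    height (l , k) = nS + nS ∸ pos l , toℕ k
    ≻ᴳ⇒lower : ∀ {x y} → x ≻ᴳ y → ×-Lex _≡_ _<_ _<_ (height x) (height y)
    ≻ᴳ⇒lower {l₁ , _} x≻y with ≻ᴳ-cases x≻y
    ... | inj₁ l₂<l₁          = inj₁ (∸-monoʳ-< l₂<l₁ (pos≤ l₁))
    ... | inj₂ (refl , _ , k₁<k₂) = inj₂ (refl , k₁<k₂)

  repS : Fin nS → W
  repS i = rep (_∈ S i)

  S-clique : ∀ i {x y} → x ∈ S i → y ∈ S i → x ≽ y
  S-clique i = strat-clique (length Fal) Fal (∈-lookup i)

  S-length≤ : ∀ i → length (S i) ≤ length Fal
  S-length≤ i = stratum-length≤ (length Fal) Fal (∈-lookup i)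

  -- Truth preservation

  module Truth (rep∈ : ∀ (P : W → Set) → Σ W P → P (rep P)) (w₀ : W) (smooth : Smooth M)
               (≽-trans : Transitive M) (≽-total : Total M) where

    repS∈S : ∀ i → repS i ∈ S i
    repS∈S i = rep∈ _ (strat-nonempty (length Fal) Fal (∈-lookup i))

    Fal⊆f-blocks : ∀ {w} → w ∈ Fal →
                   Σ (Fin nS) λ i → Σ (Fin (length (S i))) λ k → lookup (S i) k ≡ w
    Fal⊆f-blocks w∈ =
      let w∈S = strat-covers ≽-trans ≽-total (length Fal) Fal ≤-refl w∈
      in Any.index w∈S , Any.index (lookup-index w∈S) , sym (lookup-index (lookup-index w∈S))

    S-sorted : ∀ {i j} → toℕ i < toℕ j → ∀ {x y} → x ∈ S i → y ∈ S j → y ≻ᴹ x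
    S-sorted = AllPairs-lookup (strat-sorted ≽-trans (length Fal) Fal)

    chain⊆Bet : ∀ i (k : Fin (length (blk (i , true)))) → lookup (blk (i , true)) k ≻ᴹ repS i
    chain⊆Bet i = MaxSeq⊆ rep∈ (length (Cond φ)) (Bet (repS i)) (Cond φ)

    project-ascent : ∀ i k y → y ≻ᴳ ((i , false) , k) → origin y ≻ᴹ lookup (S i) k
    project-ascent i k ((j , c) , k′) y≻x with ≻ᴳ-cases y≻x
    ... | inj₂ (refl , () , _)
    ... | inj₁ lt with after-f-block {i} {j} {c} lt
    ...   | inj₂ refl = ≻-≽-trans ≽-trans (chain⊆Bet i k′) (S-clique i (repS∈S i) (∈-lookup k))
    ...   | inj₁ i<j with c
    ...     | false = S-sorted i<j (∈-lookup k) (∈-lookup k′)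
    ...     | true  = ≻-≽-trans ≽-trans (chain⊆Bet j k′) (proj₁ (S-sorted i<j (∈-lookup k) (repS∈S j)))

    lift-ascent : ∀ {α} → α ∈ Cond φ → ∀ x → origin x ⊨ α → ∀ {u} → u ⊨ α → u ≻ᴹ origin x →
                  Σ Wgen λ y → origin y ⊨ α × y ≻ᴳ x
    lift-ascent α∈ ((i , false) , k) _ uα u≻x =
      let k′ , k′α = MaxSeq-reaches rep∈ smooth (length (Cond φ)) (Bet (repS i)) (Cond φ) ≤-refl α∈
                       (λ a≻r b≽a → ≽-≻-trans ≽-trans b≽a a≻r)
                       (≻-≽-trans ≽-trans u≻x (S-clique i (∈-lookup k) (repS∈S i))) uα
      in ((i , true) , k′) , k′α , inj₁ ≤-refl , λ { (inj₁ lt) → <-asym lt ≤-refl ; (inj₂ (() , _)) }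
    lift-ascent α∈ ((i , true) , k) xα uα u≻x
      with MaxSeq-first-maximal rep∈ (length (Cond φ)) (Bet (repS i)) (Cond φ) α∈ k xα
    ... | inj₁ (_ , x-max)      = ⊥-elim (x-max (_ , uα , u≻x))
    ... | inj₂ (j , j<k , jα) =
      ((i , true) , j) , jα , inj₂ (refl , <⇒≤ j<k) ,
      λ { (inj₁ lt) → <-irrefl refl lt ; (inj₂ (_ , k≤j)) → <⇒≱ j<k k≤j }

    falOf⊆Fal : ∀ {ψ y} → ψ ∈ subs φ → y ∈ falOf ψ → y ∈ Fal
    falOf⊆Fal ψ∈ y∈ = ∈-deduplicate⁺ (λ a b → lem (a ≡ b)) (there (∈-concatMap⁺ falOf (lose ψ∈ y∈)))

    refuter∈Fal : rep (λ w → ¬ w ⊨ φ) ∈ Fal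
    refuter∈Fal = ∈-deduplicate⁺ (λ a b → lem (a ≡ b)) {xs = _ ∷ concatMap falOf (subs φ)} (here refl)

    box-falsifier : ∀ {β} → ¬ w₀ ⊨ box β → rep (λ w → ¬ w ⊨ β) ∈ falOf (box β)
    box-falsifier {β} ¬β with lem (valid M (box β))
    ... | yes valid = ⊥-elim (¬β (valid w₀))
    ... | no  _     = here refl

    O-falsifier : ∀ {γ α} → ¬ w₀ ⊨ O γ α → rep (λ w → Max M (_⊨ α) w × ¬ w ⊨ γ) ∈ falOf (O γ α)
    O-falsifier {γ} {α} ¬O with lem (valid M (O γ α))
    ... | yes valid = ⊥-elim (¬O (valid w₀))
    ... | no  _     = here refl

    O-counterexample : ∀ {γ α} → ¬ w₀ ⊨ O γ α → Σ W λ w → Max M (_⊨ α) w × ¬ w ⊨ γ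
    O-counterexample ¬O = dne λ none → ¬O λ v vα v-max → dne λ ¬vγ → none (v , (vα , v-max) , ¬vγ)

    Agree : Fm → Set
    Agree ψ = ∀ x → sat G x ψ ⇔ origin x ⊨ ψ

    box-agree : ∀ {β} → box β ∈ subs φ → Agree β → Agree (box β)
    box-agree {β} box∈ agreeβ x = mk⇔ G⇒M (λ Mβ y → from (agreeβ y) (Mβ (origin y)))
      where
      G⇒M : sat G x (box β) → origin x ⊨ box β
      G⇒M Gβ with lem (w₀ ⊨ box β)
      ... | yes Mβ = Mβ
      ... | no ¬Mβ with Fal⊆f-blocks (falOf⊆Fal box∈ (box-falsifier ¬Mβ))
      ...   | i , k , eq =
        ⊥-elim (rep∈ _ (¬∀⇒∃¬ ¬Mβ) (subst (_⊨ β) eq (to (agreeβ ((i , false) , k)) (Gβ _))))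

    O-agree : ∀ {γ α} → O γ α ∈ subs φ → Agree γ → Agree α → Agree (O γ α)
    O-agree {γ} {α} O∈ agreeγ agreeα x = mk⇔ G⇒M M⇒G
      where
      α∈Cond : α ∈ Cond φ
      α∈Cond = ∈-concatMap⁺ condOf (lose O∈ (here refl))

      M⇒G : origin x ⊨ O γ α → sat G x (O γ α)
      M⇒G Mob v vα v-max = from (agreeγ v) (Mob (origin v) (to (agreeα v) vα) λ (u , uα , u≻v) →
        let y , yα , y≻v = lift-ascent α∈Cond v (to (agreeα v) vα) uα u≻v
        in v-max (y , from (agreeα y) yα , y≻v))

      G⇒M : sat G x (O γ α) → origin x ⊨ O γ α
      G⇒M Gob with lem (w₀ ⊨ O γ α)
      ... | yes Mob = Mob
      ... | no ¬Mob with Fal⊆f-blocks (falOf⊆Fal O∈ (O-falsifier {γ} {α} ¬Mob))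
      ...   | i , k , eq = ⊥-elim (proj₂ z-bad (subst (_⊨ γ) eq (to (agreeγ x′) (Gob x′ x′α x′-max))))
        where
        z-bad = rep∈ _ (O-counterexample {γ} {α} ¬Mob)
        x′ : Wgen
        x′ = (i , false) , k
        x′α : sat G x′ α
        x′α = from (agreeα x′) (subst (_⊨ α) (sym eq) (proj₁ (proj₁ z-bad)))
        x′-max : ¬ Σ Wgen λ y → sat G y α × y ≻ᴳ x′
        x′-max (y , yα , y≻x′) =
          proj₂ (proj₁ z-bad)
            (origin y , to (agreeα y) yα , subst (origin y ≻ᴹ_) eq (project-ascent i k y y≻x′))

    truth : ∀ ψ → subs ψ ⊆ subs φ → Agree ψ
    truth (var _)  _   x = mk⇔ id id
    truth (neg ψ)  sub x = mk⇔ (λ ¬Gψ Mψ → ¬Gψ (from ih Mψ)) (λ ¬Mψ Gψ → ¬Mψ (to ih Gψ))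
      where ih = truth ψ (λ p → sub (there p)) x
    truth (ψ ∧' χ) sub x = mk⇔ (λ (p , q) → to ihψ p , to ihχ q) (λ (p , q) → from ihψ p , from ihχ q)
      where
      ihψ = truth ψ (λ p → sub (there (∈-++⁺ˡ p))) x
      ihχ = truth χ (λ p → sub (there (∈-++⁺ʳ (subs ψ) p))) x
    truth (box β)  sub = box-agree (sub (here refl)) (truth β (λ p → sub (there p)))
    truth (O γ α)  sub = O-agree (sub (here refl)) (truth γ (λ p → sub (there (∈-++⁺ˡ p))))
                                                   (truth α (λ p → sub (there (∈-++⁺ʳ (subs γ) p))))

    gen-countermodel : ¬ valid M φ → GCounter G φ
    gen-countermodel ¬Mφ with Fal⊆f-blocks refuter∈Fal
    ... | i , k , eq =
      x₀ , smooth-of-wellFounded lem G ≽ᴳ-trans ≻ᴳ-wellFounded , ≽ᴳ-trans , ≽ᴳ-total ,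
      λ Gφ → rep∈ _ (¬∀⇒∃¬ ¬Mφ) (subst (_⊨ φ) eq (to (truth φ id x₀) (Gφ x₀)))
      where
      x₀ : Wgen
      x₀ = (i , false) , k

  -- Size of the generated model

  blockSize : Label → ℕ
  blockSize l = length (blk l)

  blockPairSize : Vector ℕ nS
  blockPairSize i = blockSize (i , false) + blockSize (i , true)

  Wgen↔Fin : Wgen ↔ Fin (sum blockPairSize)
  Wgen↔Fin = ↔-trans (Σ-assoc {C = λ i b → Fin (blockSize (i , b))})
    (↔-trans (Σ-↔ ↔-refl (↔-trans (Σ-Bool↔⊎ _) (↔-sym +↔⊎))) (Σ-Fin↔Fin-sum blockPairSize))

  Fal-length≤ : length Fal ≤ size φ + size φ
  Fal-length≤ = ≤-trans (length-deduplicate (λ a b → lem (a ≡ b)) (_ ∷ concatMap falOf (subs φ)))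
    (+-mono-≤ (1≤size φ) (≤-trans (length-concatMap≤ falOf falOf≤1 (subs φ)) (length-subs≤size φ)))
    where
    falOf≤1 : ∀ ψ → length (falOf ψ) ≤ 1
    falOf≤1 (var _)  = z≤n
    falOf≤1 (neg _)  = z≤n
    falOf≤1 (_ ∧' _) = z≤n
    falOf≤1 (box β) with lem (valid M (box β))
    ... | yes _ = z≤n
    ... | no  _ = ≤-refl
    falOf≤1 (O γ α) with lem (valid M (O γ α))
    ... | yes _ = z≤n
    ... | no  _ = ≤-refl

  sum-blockPairSize≤ : sum blockPairSize ≤ 6 * (size φ * size φ)
  sum-blockPairSize≤ = begin
    sum blockPairSize                      ≤⟨ sum≤n*B blockPairSize blockPair≤ ⟩
    nS * (length Fal + length (Cond φ))    ≤⟨ *-mono-≤ nS≤ (+-mono-≤ Fal-length≤ (length-Cond≤size φ)) ⟩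
    (s + s) * (s + s + s)                  ≡⟨ 2n*3n≡6n² s ⟩
    6 * (s * s)                            ∎
    where
    open ≤-Reasoning
    s = size φ
    blockPair≤ : ∀ i → blockPairSize i ≤ length Fal + length (Cond φ)
    blockPair≤ i = +-mono-≤ (S-length≤ i) (length-MaxSeq≤ (length (Cond φ)) (Bet (repS i)) (Cond φ))
    nS≤ : nS ≤ s + s
    nS≤ = ≤-trans (length-strat≤ (length Fal) Fal) Fal-length≤
    2n*3n≡6n² : ∀ n → (n + n) * (n + n + n) ≡ 6 * (n * n)
    2n*3n≡6n² = solve-∀

theorem3p27 : Σ ℕ λ C → (lem : LEM) → (φ : Fm) (M : Model)
    (rep : (Model.W M → Set) → Model.W M) → IsRep M rep → GCounter M φ →
    GCounter (Construction.gen lem M rep φ) φ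
    × Σ ℕ (λ N → (Model.W (Construction.gen lem M rep φ) ↔ Fin N)
    × N ≤ C * (size φ * size φ))
theorem3p27 = 6 , λ lem φ M rep (rep∈ , _) (w₀ , smooth , ≽-trans , ≽-total , ¬Mφ) →
  let open SMC lem M rep φ in
  Truth.gen-countermodel rep∈ w₀ smooth ≽-trans ≽-total ¬Mφ ,
  sum blockPairSize , Wgen↔Fin , sum-blockPairSize≤
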